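{- Let $\alpha=\mathtt{a}_1\mathtt{a}_2\cdots\mathtt{a}_n$ be a necklace over a totally ordered alphabet. Then for any $1\le i<j\le n$ and any symbol $\mathtt{x}<\mathtt{a}_i$, the string $\beta=\mathtt{a}_j\cdots\mathtt{a}_n\mathtt{a}_1\cdots\mathtt{a}_{i-1}\mathtt{x}\mathtt{a}_{i+1}\cdots\mathtt{a}_{j-1}$ is not a necklace.
   Context: A necklace is a string that is lexicographically smallest among all of its rotations. -}

module Defs where

open import Level using (Level)
open import Data.Nat using (ℕ; suc; _<_; _≤_; _∸_; s≤s; z≤n)
open import Data.List using (List; _∷_; []; _++_; take; drop; length)
open import Data.List.Relation.Binary.Lex.Core using (Lex-≤)
open import Relation.Binary.Bundles using (StrictTotalOrder)

module _ {c ℓ₁ ℓ₂ : Level} (O : StrictTotalOrder c ℓ₁ ℓ₂) where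
  open StrictTotalOrder O renaming (Carrier to A; _<_ to _≺_)

  _≤ₗ_ : List A → List A → Set _
  _≤ₗ_ = Lex-≤ _≈_ _≺_

  rotate : ℕ → List A → List A
  rotate k w = drop k w ++ take k w

  IsNecklace : List A → Set _
  IsNecklace w = ∀ k → k < length w → w ≤ₗ rotate k w

  -- β = a_j ⋯ a_n a_1 ⋯ a_{i-1} x a_{i+1} ⋯ a_{j-1}   (1-based i < j)
  beta : List A → ℕ → ℕ → A → List A
  beta w i j x =
    drop (j ∸ 1) w ++ (take (i ∸ 1) w ++ (x ∷ drop i (take (j ∸ 1) w)))

  symbolAt : (w : List A) (i : ℕ) → 1 ≤ i → i ≤ length w → A
  symbolAt (a ∷ _)  1             _ _         = a
  symbolAt (_ ∷ w) (suc (suc i))  _ (s≤s i≤n) = symbolAt w (suc i) (s≤s z≤n) i≤n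

-- Write α = P ++ S with P = a_1 ⋯ a_{j-1} and S = a_j ⋯ a_n nonempty, and let Q be P with a_i
-- replaced by x, so β = S ++ Q. Compare only the first i symbols: α ≤ S ++ P since α is a
-- necklace, S ++ P and S ++ Q = β agree on their first i symbols, and β ≤ Q ++ S if β is a
-- necklace. Hence a_1 ⋯ a_{i-1} a_i ≤ a_1 ⋯ a_{i-1} x, contradicting x < a_i.
module Submission where

open import Defs
open import Level using (Level)
open import Data.Nat using (ℕ; zero; suc; _+_; _⊓_; _≤_; _<_; s≤s; z≤n)
open import Data.Nat.Properties
  using (<⇒≤; ≤-trans; +-monoˡ-≤; m<m+n; m≤n⇒m⊓n≡m; m<n⇒0<n∸m)
open import Data.List using (List; []; _∷_; _++_; take; drop; length)
open import Data.List.Properties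
  using (++-assoc; length-++; length-++-sucʳ; length-take; length-drop; take-take)
open import Data.List.Relation.Binary.Lex.Core using (Lex-≤; base; halt; this; next)
open import Data.List.Relation.Binary.Lex.Strict using (≤-transitive)
open import Data.Unit using (tt)
open import Relation.Nullary using (¬_)
open import Relation.Binary.Core using (Rel)
open import Relation.Binary.Bundles using (StrictTotalOrder)
open import Relation.Binary.Structures using (IsStrictPartialOrder)
open import Relation.Binary.PropositionalEquality
  using (_≡_; refl; sym; trans; cong; cong₂; subst; subst₂; module ≡-Reasoning)

module _ {a} {A : Set a} where

  length-take-≤ : ∀ {n} (xs : List A) → n ≤ length xs → length (take n xs) ≡ n
  length-take-≤ {n} xs n≤ = trans (length-take n xs) (m≤n⇒m⊓n≡m n≤)

  take-length-++ : ∀ (xs ys : List A) → take (length xs) (xs ++ ys) ≡ xs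
  take-length-++ []       ys = refl
  take-length-++ (x ∷ xs) ys = cong (x ∷_) (take-length-++ xs ys)

  drop-length-++ : ∀ (xs ys : List A) → drop (length xs) (xs ++ ys) ≡ ys
  drop-length-++ []       ys = refl
  drop-length-++ (x ∷ xs) ys = drop-length-++ xs ys

  take-take-++ : ∀ {m n} (xs : List A) {ys} → m ≤ n → m ≤ length xs →
                 take m (take m xs ++ ys) ≡ take m (take n xs)
  take-take-++ xs       z≤n       _         = refl
  take-take-++ (x ∷ xs) (s≤s m≤n) (s≤s m≤l) = cong (x ∷_) (take-take-++ xs m≤n m≤l)

  take-≤-cong : ∀ {m n} {xs ys : List A} → m ≤ n →
                take n xs ≡ take n ys → take m xs ≡ take m ys
  take-≤-cong {m} {n} {xs} {ys} m≤n eq = begin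
    take m xs            ≡⟨ cong (λ k → take k xs) (sym (m≤n⇒m⊓n≡m m≤n)) ⟩
    take (m ⊓ n) xs      ≡⟨ sym (take-take m n xs) ⟩
    take m (take n xs)   ≡⟨ cong (take m) eq ⟩
    take m (take n ys)   ≡⟨ take-take m n ys ⟩
    take (m ⊓ n) ys      ≡⟨ cong (λ k → take k ys) (m≤n⇒m⊓n≡m m≤n) ⟩
    take m ys            ∎
    where open ≡-Reasoning

  take-++ˡ-cong : ∀ {n} (zs : List A) {xs ys} → take n xs ≡ take n ys →
                  take (length zs + n) (zs ++ xs) ≡ take (length zs + n) (zs ++ ys)
  take-++ˡ-cong []       eq = eq
  take-++ˡ-cong (z ∷ zs) eq = cong (z ∷_) (take-++ˡ-cong zs eq)

  take-suc-++ˡ-cong : ∀ {n} (zs : List A) {xs ys} → 0 < length zs →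
                      take n xs ≡ take n ys → take (suc n) (zs ++ xs) ≡ take (suc n) (zs ++ ys)
  take-suc-++ˡ-cong {n} zs 0<l eq = take-≤-cong (+-monoˡ-≤ n 0<l) (take-++ˡ-cong zs eq)

module _ {a ℓ₁ ℓ₂} {A : Set a} {_≈_ : Rel A ℓ₁} {_≺_ : Rel A ℓ₂} where

  Lex-≤-take : ∀ n {xs ys} → Lex-≤ _≈_ _≺_ xs ys → Lex-≤ _≈_ _≺_ (take n xs) (take n ys)
  Lex-≤-take zero    _             = base tt
  Lex-≤-take (suc n) (base p)      = base p
  Lex-≤-take (suc n) halt          = halt
  Lex-≤-take (suc n) (this x≺y)    = this x≺y
  Lex-≤-take (suc n) (next x≈y le) = next x≈y (Lex-≤-take n le)

  module _ (spo : IsStrictPartialOrder _≈_ _≺_) where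
    open IsStrictPartialOrder spo

    Lex-≤-take-descent : ∀ (ps : List A) {x y xs ys} →
      Lex-≤ _≈_ _≺_ (take (suc (length ps)) (ps ++ x ∷ xs))
                    (take (suc (length ps)) (ps ++ y ∷ ys)) →
      ¬ (y ≺ x)
    Lex-≤-take-descent []       (this x≺y)   y≺x = asym x≺y y≺x
    Lex-≤-take-descent []       (next x≈y _) y≺x = irrefl (Eq.sym x≈y) y≺x
    Lex-≤-take-descent (p ∷ ps) (this p≺p)   _   = irrefl Eq.refl p≺p
    Lex-≤-take-descent (p ∷ ps) (next _ le)  y≺x = Lex-≤-take-descent ps le y≺x

module _ {c ℓ₁ ℓ₂} (O : StrictTotalOrder c ℓ₁ ℓ₂) where
  open StrictTotalOrder O using () renaming (Carrier to A)

  rotate-length-++ : ∀ (xs ys : List A) → rotate O (length xs) (xs ++ ys) ≡ ys ++ xs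
  rotate-length-++ xs ys = cong₂ _++_ (drop-length-++ xs ys) (take-length-++ xs ys)

  necklace-≤-swap : ∀ (xs ys : List A) → IsNecklace O (xs ++ ys) → 0 < length ys →
                    _≤ₗ_ O (xs ++ ys) (ys ++ xs)
  necklace-≤-swap xs ys neck 0<l =
    subst (_≤ₗ_ O (xs ++ ys)) (rotate-length-++ xs ys) (neck (length xs) |xs|<|xs++ys|)
    where
    |xs|<|xs++ys| : length xs < length (xs ++ ys)
    |xs|<|xs++ys| = subst (length xs <_) (sym (length-++ xs)) (m<m+n (length xs) 0<l)

  take++symbolAt∷drop : ∀ (w : List A) i (i<n : suc i ≤ length w) →
    w ≡ take i w ++ symbolAt O w (suc i) (s≤s z≤n) i<n ∷ drop (suc i) w
  take++symbolAt∷drop (x ∷ w) zero    _          = refl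
  take++symbolAt∷drop (x ∷ w) (suc i) (s≤s i<n) = cong (x ∷_) (take++symbolAt∷drop w i i<n)

lemma9 : ∀ {c ℓ₁ ℓ₂ : Level} (O : StrictTotalOrder c ℓ₁ ℓ₂)
    (α : List (StrictTotalOrder.Carrier O)) → IsNecklace O α →
    (i j : ℕ) (1≤i : 1 ≤ i) (i<j : i < j) (j≤n : j ≤ length α) →
    (x : StrictTotalOrder.Carrier O) →
    StrictTotalOrder._<_ O x (symbolAt O α i 1≤i (≤-trans (<⇒≤ i<j) j≤n)) →
    ¬ IsNecklace O (beta O α i j x)
lemma9 O α α-neck (suc i) (suc k) (s≤s z≤n) (s≤s i<k) k<n x x≺a β-neck =
  Lex-≤-take-descent isStrictPartialOrder p descent x≺a
  where
  open StrictTotalOrder O using (isStrictPartialOrder; isEquivalence; <-resp-≈)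
    renaming (trans to ≺-trans)

  p = take i α
  P = take k α
  S = drop k α
  t = drop (suc i) P
  Q = p ++ x ∷ t
  a = symbolAt O α (suc i) (s≤s z≤n) (≤-trans (<⇒≤ (s≤s i<k)) k<n)

  i≤n : i ≤ length α
  i≤n = ≤-trans (<⇒≤ i<k) (<⇒≤ k<n)

  Q≈P : take i Q ≡ take i P
  Q≈P = take-take-++ α (<⇒≤ i<k) i≤n

  SP≈SQ : take (suc i) (S ++ P) ≡ take (suc i) (S ++ Q)
  SP≈SQ = sym (take-suc-++ˡ-cong S (subst (0 <_) (sym (length-drop k α)) (m<n⇒0<n∸m k<n)) Q≈P)

  β≤QS : _≤ₗ_ O (S ++ Q) (Q ++ S)
  β≤QS = necklace-≤-swap O S Q β-neck (subst (0 <_) (sym (length-++-sucʳ p x t)) (s≤s z≤n))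

  chain : _≤ₗ_ O (take (suc i) α) (take (suc i) (Q ++ S))
  chain = ≤-transitive isEquivalence <-resp-≈ ≺-trans
    (subst (_≤ₗ_ O (take (suc i) α)) SP≈SQ (Lex-≤-take (suc i) (α-neck k k<n)))
    (Lex-≤-take (suc i) β≤QS)

  descent : _≤ₗ_ O (take (suc (length p)) (p ++ a ∷ drop (suc i) α))
                   (take (suc (length p)) (p ++ x ∷ (t ++ S)))
  descent rewrite length-take-≤ α i≤n =
    subst₂ (λ u v → _≤ₗ_ O (take (suc i) u) (take (suc i) v))
      (take++symbolAt∷drop O α i (≤-trans (<⇒≤ (s≤s i<k)) k<n)) (++-assoc p (x ∷ t) S) chain
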